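{- For every integer $n \geq 3$, the corona $C_n \odot 3K_1$ admits a signed product cordial labeling.
   Context: All graphs are finite, simple and undirected. A vertex labeling $\alpha: V(G) \to \{1,-1\}$ induces the edge labeling $\alpha^*: E(G) \to \{1,-1\}$ given by $\alpha^*(uv) = \alpha(u)\alpha(v)$. For $a \in \{1,-1\}$, let $v_\alpha(a)$ be the number of vertices labeled $a$ and $e_{\alpha^*}(a)$ the number of edges labeled $a$. The labeling $\alpha$ is a signed product cordial labeling if $|v_\alpha(-1) - v_\alpha(1)| \leq 1$ and $|e_{\alpha^*}(-1) - e_{\alpha^*}(1)| \leq 1$. The corona $G_1 \odot G_2$ of graphs $G_1$ (with $n_1$ vertices) and $G_2$ is obtained by taking one copy of $G_1$ and $n_1$ disjoint copies of $G_2$ and joining the $i$-th vertex of $G_1$ by an edge to every vertex of the $i$-th copy of $G_2$. Here $C_n$ is the cycle on $n$ vertices and $3K_1$ is the edgeless graph on $3$ vertices, so $C_n \odot 3K_1$ is the cycle $u_1u_2\cdots u_nu_1$ together with, for each $x$, three new pendant vertices $v_x, w_x, t_x$ adjacent only to $u_x$. -}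

module Defs where

open import Data.Nat using (ℕ; zero; suc; _+_; _≤_; ∣_-_∣)
open import Data.Nat.DivMod using (_%_)
open import Data.Fin using (Fin; toℕ; fromℕ<)
open import Data.Fin.Properties using ()
open import Data.List using (List; []; _∷_; map; concatMap; allFin; filter; length; _++_)
open import Data.Product using (_×_; _,_; proj₁; proj₂)
open import Data.Sum using (_⊎_; inj₁; inj₂)
open import Data.Sign using (Sign; +; -) renaming (_*_ to _*ₛ_)
open import Data.Sign.Properties using () renaming (_≟_ to _≟ₛ_)
open import Data.Nat.DivMod using (m%n<n)
open import Relation.Nullary using (Dec)

-- A finite simple graph, presented by a list enumerating its vertices
-- (each exactly once) and a list of its edges (each unordered edge exactly
-- once, given as an ordered pair of its endpoints).
record Graph : Set₁ where
  field
    V        : Set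
    vertices : List V
    edges    : List (V × V)
open Graph public

-- Cycle C_n on vertices 0,…,n-1 with edges {i, i+1 mod n}.
-- (Simple for n ≥ 3.)
cycleGraph : (n : ℕ) → Graph
cycleGraph zero    = record { V = Fin zero ; vertices = [] ; edges = [] }
cycleGraph (suc k) = record
  { V        = Fin (suc k)
  ; vertices = allFin (suc k)
  ; edges    = map (λ i → i , fromℕ< (m%n<n (suc (toℕ i)) (suc k))) (allFin (suc k))
  }

emptyGraph : ℕ → Graph
emptyGraph m = record { V = Fin m ; vertices = allFin m ; edges = [] }

-- Corona G₁ ⊙ G₂: one copy of G₁ (vertices inj₁ x) and, for each vertex x of
-- G₁, a copy of G₂ (vertices inj₂ (x , y)), with x joined to every vertex of
-- its copy.
corona : Graph → Graph → Graph
corona G₁ G₂ = record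
  { V        = V G₁ ⊎ (V G₁ × V G₂)
  ; vertices = map inj₁ (vertices G₁)
               ++ concatMap (λ x → map (λ y → inj₂ (x , y)) (vertices G₂)) (vertices G₁)
  ; edges    = map (λ e → inj₁ (proj₁ e) , inj₁ (proj₂ e)) (edges G₁)
               ++ concatMap (λ x → map (λ e → inj₂ (x , proj₁ e) , inj₂ (x , proj₂ e)) (edges G₂)) (vertices G₁)
               ++ concatMap (λ x → map (λ y → inj₁ x , inj₂ (x , y)) (vertices G₂)) (vertices G₁)
  }

countSign : {A : Set} → (A → Sign) → Sign → List A → ℕ
countSign f a xs = length (filter (λ x → f x ≟ₛ a) xs)

vCount : (G : Graph) → (V G → Sign) → Sign → ℕ
vCount G α a = countSign α a (vertices G)

edgeLabel : (G : Graph) → (V G → Sign) → V G × V G → Sign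
edgeLabel G α (u , v) = α u *ₛ α v

eCount : (G : Graph) → (V G → Sign) → Sign → ℕ
eCount G α a = countSign (edgeLabel G α) a (edges G)

absDiff : ℕ → ℕ → ℕ
absDiff m n = ∣ m - n ∣

IsSignedProductCordial : (G : Graph) → (V G → Sign) → Set
IsSignedProductCordial G α =
  absDiff (vCount G α -) (vCount G α +) ≤ 1 ×
  absDiff (eCount G α -) (eCount G α +) ≤ 1

SignedProductCordial : Graph → Set
SignedProductCordial G = Data.Product.Σ (V G → Sign) (IsSignedProductCordial G)

{-# OPTIONS --safe #-}
-- Label every vertex of G with + and, at each hub, its three pendants with −, −, +.
-- Both vertex classes then have 2|V| elements; the spokes carry the pendant labels,
-- so 2|V| edges are labelled − and |V| + |E| are labelled +.  The edge counts are
-- therefore balanced up to ||V| − |E||, which is 0 for a cycle.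
module Submission where

open import Defs
open import Data.Nat using (ℕ; zero; suc; _+_; _*_; _≤_; z≤n)
open import Data.Nat.Properties
  using (+-comm; *-suc; *-zeroʳ; *-identityʳ; ≤-trans; ≤-reflexive; m≡n⇒∣m-n∣≡0; ∣m+n-m+o∣≡∣n-o∣)
open import Data.Fin using (Fin)
open import Data.Fin.Patterns using (0F; 1F; 2F)
open import Data.List using (List; []; _∷_; map; concatMap; filter; length; _++_; allFin)
open import Data.List.Properties using (filter-++; filter-all; filter-none; length-++; length-map)
open import Data.List.Relation.Unary.All using (universal)
open import Data.Product using (_×_; _,_; proj₁; proj₂)
open import Data.Sum using (inj₁; inj₂)
open import Data.Sign as Sign using (Sign)
open import Data.Sign.Properties using (_≟_)
open import Function using (_∘_; const)
open import Relation.Nullary using (yes; no)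
open import Relation.Binary.PropositionalEquality using (_≡_; _≢_; refl; sym; trans; cong; cong₂; subst; module ≡-Reasoning)

module _ {A : Set} (f : A → Sign) (a : Sign) where

  countSign-++ : (xs ys : List A) →
                 countSign f a (xs ++ ys) ≡ countSign f a xs + countSign f a ys
  countSign-++ xs ys = trans (cong length (filter-++ (λ x → f x ≟ a) xs ys))
                             (length-++ (filter (λ x → f x ≟ a) xs))

  countSign-concatMap : {B : Set} {g : B → List A} {c : ℕ} →
                        (∀ y → countSign f a (g y) ≡ c) →
                        ∀ ys → countSign f a (concatMap g ys) ≡ length ys * c
  countSign-concatMap         count-g []       = refl
  countSign-concatMap {g = g} count-g (y ∷ ys) =
    trans (countSign-++ (g y) (concatMap g ys))
          (cong₂ _+_ (count-g y) (countSign-concatMap count-g ys))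

countSign-map : {A B : Set} (f : B → Sign) (g : A → B) (a : Sign) (xs : List A) →
                countSign f a (map g xs) ≡ countSign (f ∘ g) a xs
countSign-map f g a []       = refl
countSign-map f g a (x ∷ xs) with f (g x) ≟ a
... | yes _ = cong suc (countSign-map f g a xs)
... | no  _ = countSign-map f g a xs

countSign-const : {A : Set} (a : Sign) (xs : List A) → countSign (const a) a xs ≡ length xs
countSign-const a xs = cong length (filter-all (λ _ → a ≟ a) (universal (λ _ → refl) xs))

countSign-const-≢ : {A : Set} {s a : Sign} → s ≢ a → (xs : List A) → countSign (const s) a xs ≡ 0
countSign-const-≢ {s = s} {a} s≢a xs =
  cong length (filter-none (λ _ → s ≟ a) (universal (λ _ → s≢a) xs))

absDiff≤1-≡ : {a b : ℕ} → a ≡ b → absDiff a b ≤ 1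
absDiff≤1-≡ a≡b = ≤-trans (≤-reflexive (m≡n⇒∣m-n∣≡0 a≡b)) z≤n

pendantLabel : Fin 3 → Sign
pendantLabel 0F = Sign.-
pendantLabel 1F = Sign.-
pendantLabel 2F = Sign.+

coronaLabel : (G : Graph) → V (corona G (emptyGraph 3)) → Sign
coronaLabel G (inj₁ _)       = Sign.+
coronaLabel G (inj₂ (_ , y)) = pendantLabel y

module _ (G : Graph) where

  private
    H : Graph
    H = corona G (emptyGraph 3)

    α : V H → Sign
    α = coronaLabel G

    n m : ℕ
    n = length (vertices G)
    m = length (edges G)

    hubs pendants : List (V H)
    hubs     = map inj₁ (vertices G)
    pendants = concatMap (λ x → map (λ y → inj₂ (x , y)) (allFin 3)) (vertices G)

    baseEdges copyEdges spokes : List (V H × V H)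
    baseEdges = map (λ e → inj₁ (proj₁ e) , inj₁ (proj₂ e)) (edges G)
    copyEdges = concatMap (λ x → map (λ e → inj₂ (x , proj₁ e) , inj₂ (x , proj₂ e)) []) (vertices G)
    spokes    = concatMap (λ x → map (λ y → inj₁ x , inj₂ (x , y)) (allFin 3)) (vertices G)

    n*2≡n+n : n * 2 ≡ n + n
    n*2≡n+n = trans (*-suc n 1) (cong (n +_) (*-identityʳ n))

  vCount-coronaLabel⁻ : vCount H α Sign.- ≡ n + n
  vCount-coronaLabel⁻ = begin
    countSign α Sign.- (hubs ++ pendants)
      ≡⟨ countSign-++ α Sign.- hubs pendants ⟩
    countSign α Sign.- hubs + countSign α Sign.- pendants
      ≡⟨ cong₂ _+_ (trans (countSign-map α inj₁ Sign.- (vertices G)) (countSign-const-≢ (λ ()) (vertices G)))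
                   (countSign-concatMap α Sign.- (λ _ → refl) (vertices G)) ⟩
    n * 2
      ≡⟨ n*2≡n+n ⟩
    n + n ∎
    where open ≡-Reasoning

  vCount-coronaLabel⁺ : vCount H α Sign.+ ≡ n + n
  vCount-coronaLabel⁺ = begin
    countSign α Sign.+ (hubs ++ pendants)
      ≡⟨ countSign-++ α Sign.+ hubs pendants ⟩
    countSign α Sign.+ hubs + countSign α Sign.+ pendants
      ≡⟨ cong₂ _+_ (trans (countSign-map α inj₁ Sign.+ (vertices G)) (countSign-const Sign.+ (vertices G)))
                   (trans (countSign-concatMap α Sign.+ (λ _ → refl) (vertices G)) (*-identityʳ n)) ⟩
    n + n ∎
    where open ≡-Reasoning

  eCount-coronaLabel⁻ : eCount H α Sign.- ≡ n + n
  eCount-coronaLabel⁻ = begin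
    countSign β Sign.- (baseEdges ++ copyEdges ++ spokes)
      ≡⟨ countSign-++ β Sign.- baseEdges (copyEdges ++ spokes) ⟩
    countSign β Sign.- baseEdges + countSign β Sign.- (copyEdges ++ spokes)
      ≡⟨ cong (countSign β Sign.- baseEdges +_) (countSign-++ β Sign.- copyEdges spokes) ⟩
    countSign β Sign.- baseEdges + (countSign β Sign.- copyEdges + countSign β Sign.- spokes)
      ≡⟨ cong₂ _+_ (trans (countSign-map β _ Sign.- (edges G)) (countSign-const-≢ (λ ()) (edges G)))
           (cong₂ _+_ (trans (countSign-concatMap β Sign.- (λ _ → refl) (vertices G)) (*-zeroʳ n))
                      (countSign-concatMap β Sign.- (λ _ → refl) (vertices G))) ⟩
    n * 2
      ≡⟨ n*2≡n+n ⟩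
    n + n ∎
    where
    open ≡-Reasoning
    β = edgeLabel H α

  eCount-coronaLabel⁺ : eCount H α Sign.+ ≡ n + m
  eCount-coronaLabel⁺ = begin
    countSign β Sign.+ (baseEdges ++ copyEdges ++ spokes)
      ≡⟨ countSign-++ β Sign.+ baseEdges (copyEdges ++ spokes) ⟩
    countSign β Sign.+ baseEdges + countSign β Sign.+ (copyEdges ++ spokes)
      ≡⟨ cong (countSign β Sign.+ baseEdges +_) (countSign-++ β Sign.+ copyEdges spokes) ⟩
    countSign β Sign.+ baseEdges + (countSign β Sign.+ copyEdges + countSign β Sign.+ spokes)
      ≡⟨ cong₂ _+_ (trans (countSign-map β _ Sign.+ (edges G)) (countSign-const Sign.+ (edges G)))
           (cong₂ _+_ (trans (countSign-concatMap β Sign.+ (λ _ → refl) (vertices G)) (*-zeroʳ n))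
                      (trans (countSign-concatMap β Sign.+ (λ _ → refl) (vertices G)) (*-identityʳ n))) ⟩
    m + n
      ≡⟨ +-comm m n ⟩
    n + m ∎
    where
    open ≡-Reasoning
    β = edgeLabel H α

  coronaLabel-isSignedProductCordial : absDiff n m ≤ 1 → IsSignedProductCordial H α
  coronaLabel-isSignedProductCordial ∣n-m∣≤1 =
    absDiff≤1-≡ (trans vCount-coronaLabel⁻ (sym vCount-coronaLabel⁺)) ,
    subst (_≤ 1) (sym edgeDifference) ∣n-m∣≤1
    where
    edgeDifference : absDiff (eCount H α Sign.-) (eCount H α Sign.+) ≡ absDiff n m
    edgeDifference = trans (cong₂ absDiff eCount-coronaLabel⁻ eCount-coronaLabel⁺) (∣m+n-m+o∣≡∣n-o∣ n n m)

cycleGraph-size≡order : (n : ℕ) → length (edges (cycleGraph n)) ≡ length (vertices (cycleGraph n))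
cycleGraph-size≡order zero    = refl
cycleGraph-size≡order (suc k) = length-map _ (allFin (suc k))

theorem2p4 : (n : ℕ) → 3 ≤ n → SignedProductCordial (corona (cycleGraph n) (emptyGraph 3))
-- The bound 3 ≤ n only makes the cycle simple; the labelling works for every n.
theorem2p4 n _ =
  coronaLabel (cycleGraph n) ,
  coronaLabel-isSignedProductCordial (cycleGraph n) (absDiff≤1-≡ (sym (cycleGraph-size≡order n)))
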